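{- Let $\Gamma$ be a finite, connected, simple, undirected graph with at least one edge, $G$ a group, and $s_1,s_2\in Z(G)$ with $s_1^2=s_2^2=1_G$. For $H_1,H_2\in\mathcal H_\Gamma$ the following are equivalent: (1) $H_1\sim_{l\times r}H_2$; (2) $\Psi(H_1)$ and $\Psi(H_2)$ are switching equivalent; (3) $\Psi_L(H_1)$ and $\Psi_L(H_2)$ are switching equivalent. In particular, there exists an injective map $\mathcal L\colon[G(\Gamma)]\to[G(L(\Gamma))]$ such that $\mathcal L([\Psi(H)])=[\Psi_L(H)]$ for every $H\in\mathcal H_\Gamma$.
   Context: Fix orders $V_\Gamma=\{v_1,\dots,v_n\}$, $E_\Gamma=\{e_1,\dots,e_m\}$; write $v_i\in e_j$ if $v_i$ is an endpoint of $e_j$, and $e_i\cap e_j$ for the common endpoint of distinct edges sharing a vertex. $\mathbb CG$ is the complex group algebra with involution $(\sum f_xx)^*=\sum\overline{f_x}x^{ -1}$, and $(A^*)_{i,j}=(A_{j,i})^*$. A $G$-phase is $H\in M_{n\times m}(\mathbb CG)$ with $H_{i,j}\in G$ if $v_i\in e_j$ and $H_{i,j}=0$ otherwise; $\mathcal H_\Gamma$ is their set. For $g\in G^k$, $\underline g=\mathrm{diag}(g_1,\dots,g_k)$; $H_1\sim_{l\times r}H_2$ means $H_1=\underline f^{\,*}H_2\underline g$ for some $f\in G^n,g\in G^m$. A $G$-gain function on a graph is a map $\psi$ on ordered pairs of adjacent vertices into $G$ with $\psi(v,u)=\psi(u,v)^{ -1}$; $G(\Gamma)$ is the set of such on $\Gamma$.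 Two gain functions $\psi_1,\psi_2$ on the same graph are switching equivalent if there is a map $f$ from vertices to $G$ with $\psi_2(u,v)=f(u)^{ -1}\psi_1(u,v)f(v)$ for all adjacent $u,v$; $[G(\Gamma)]$ is the set of switching classes and $[\psi]$ the class of $\psi$. $\Psi(H)$ is the gain function on $\Gamma$ with $\Psi(H)(v_i,v_j)=s_1H_{i,k}H_{j,k}^{ -1}$ for $e_k=\{v_i,v_j\}$. The line graph $L(\Gamma)$ has vertex set $E_\Gamma$, $e_i\sim e_j$ iff they share an endpoint; $\Psi_L(H)$ is the gain function on $L(\Gamma)$ with $\Psi_L(H)(e_i,e_j)=s_2H_{k,i}^{ -1}H_{k,j}$ for $v_k=e_i\cap e_j$. -}

module Defs where

open import Level using (Level; _⊔_)
open import Data.Nat using (ℕ; NonZero)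
open import Data.Fin using (Fin)
open import Data.Product using (Σ; ∃; _×_; _,_)
open import Data.Sum using (_⊎_)
open import Relation.Binary.PropositionalEquality using (_≡_; _≢_)
open import Relation.Nullary using (¬_)
open import Algebra.Bundles using (Group)

-- Finite simple undirected graphs with ordered vertex set
-- V = {v_0,..,v_{n-1}} = Fin n and edge set E = {e_0,..,e_{m-1}} = Fin m.
-- Edge e_k = {src k , tgt k}.

record Graph : Set where
  field
    n m    : ℕ
    src    : Fin m → Fin n
    tgt    : Fin m → Fin n
    loopless : ∀ k → src k ≢ tgt k
    simple : ∀ k k' →
             ((src k ≡ src k' × tgt k ≡ tgt k') ⊎ (src k ≡ tgt k' × tgt k ≡ src k')) →
             k ≡ k'

module _ (Γ : Graph) where
  open Graph Γ

  Inc : Fin n → Fin m → Set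
  Inc v k = v ≡ src k ⊎ v ≡ tgt k

  Adj : Fin n → Fin n → Set
  Adj u v = Σ (Fin m) λ k → (src k ≡ u × tgt k ≡ v) ⊎ (src k ≡ v × tgt k ≡ u)

  LAdj : Fin m → Fin m → Set
  LAdj i j = i ≢ j × Σ (Fin n) λ v → Inc v i × Inc v j

  data Reachable : Fin n → Fin n → Set where
    here : ∀ {u} → Reachable u u
    step : ∀ {u v w} → Adj u v → Reachable v w → Reachable u w

  Connected : Set
  Connected = ∀ u v → Reachable u v

  HasEdge : Set
  HasEdge = NonZero m

-- A (raw) function is given on ordered pairs of adjacent vertices
-- (it may a priori see the adjacency witness; IsGain forces it to be
-- independent of it).

module _ {c ℓ : Level} (G : Group c ℓ) where
  open Group G

  RawGain : (V : Set) → (V → V → Set) → Set c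
  RawGain V A = (u v : V) → A u v → Carrier

  IsGain : {V : Set} (A : V → V → Set) → RawGain V A → Set ℓ
  IsGain {V} A ψ = ∀ (u v : V) (p : A u v) (q : A v u) → ψ v u q ≈ (ψ u v p) ⁻¹

  SwitchEq : {V : Set} (A : V → V → Set) → RawGain V A → RawGain V A → Set (c ⊔ ℓ)
  SwitchEq {V} A ψ₁ ψ₂ =
    Σ (V → Carrier) λ f → ∀ (u v : V) (p : A u v) → ψ₂ u v p ≈ ((f u) ⁻¹ ∙ ψ₁ u v p) ∙ f v

  Central : Carrier → Set (c ⊔ ℓ)
  Central s = ∀ x → s ∙ x ≈ x ∙ s

  module _ (Γ : Graph) where
    open Graph Γ

    -- A G-phase: the entries H i k are only relevant when v_i ∈ e_k
    -- (otherwise the entry of the matrix over ℂG is 0).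
    Phase : Set c
    Phase = Fin n → Fin m → Carrier

    -- H₁ ∼_{l×r} H₂ : H₁ = f* H₂ g, entrywise (f_i)⁻¹ (H₂)_{ik} g_k on
    -- incident pairs (both sides are 0 elsewhere).
    LRequiv : Phase → Phase → Set (c ⊔ ℓ)
    LRequiv H₁ H₂ = Σ (Fin n → Carrier) λ f → Σ (Fin m → Carrier) λ g →
      ∀ i k → Inc Γ i k → H₁ i k ≈ ((f i) ⁻¹ ∙ H₂ i k) ∙ g k

    Ψ : Carrier → Phase → RawGain (Fin n) (Adj Γ)
    Ψ s₁ H i j (k , _) = (s₁ ∙ H i k) ∙ (H j k) ⁻¹

    ΨL : Carrier → Phase → RawGain (Fin m) (LAdj Γ)
    ΨL s₂ H i j (_ , k , _) = (s₂ ∙ (H k i) ⁻¹) ∙ H k j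

Vtx : Graph → Set
Vtx Γ = Fin (Graph.n Γ)

Edg : Graph → Set
Edg Γ = Fin (Graph.m Γ)

-- Both ∼_{l×r} and switching equivalence say that one family of group
-- elements is obtained from another by twisting x ↦ f⁻¹ x g, and twists
-- compose under products and inverses.  Hence twisting H by (f , g) twists
-- Ψ(H) by f and Ψ_L(H) by g, the central signs being carried along.
-- Conversely a switching function of Ψ(H) (resp. Ψ_L(H)) can be extended
-- to the missing edge (resp. vertex) factor by solving the twist equation
-- at one endpoint (resp. one incident edge) and checking it at the other
-- ones.  Every gain function ψ is Ψ of a phase (put ψ(e) at the source of
-- e and s₁ at its target), so 𝓛 ψ := Ψ_L of that phase is well defined and
-- injective on switching classes.

module Submission where

open import Defs
open import Level using (Level)
open import Data.Nat using (>-nonZero⁻¹)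
open import Data.Fin using (Fin; fromℕ<)
open import Data.Fin.Properties using (_≟_)
open import Data.Product using (Σ; _×_; _,_; proj₁; proj₂)
open import Data.Sum using (_⊎_; inj₁; inj₂)
open import Data.Empty using (⊥-elim)
open import Function.Base using (_∘_)
open import Function.Bundles using (_⇔_; mk⇔; Equivalence)
open import Algebra.Bundles using (Group)
open import Relation.Nullary using (yes; no)
open import Relation.Binary.PropositionalEquality as ≡ using (_≡_; _≢_)

module Twist {c ℓ} (G : Group c ℓ) where
  open Group G
  open import Algebra.Properties.Group G
  open import Relation.Binary.Reasoning.Setoid setoid

  twist-refl : ∀ x → x ≈ (ε ⁻¹ ∙ x) ∙ ε
  twist-refl x = sym (begin
    (ε ⁻¹ ∙ x) ∙ ε  ≈⟨ identityʳ _ ⟩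
    ε ⁻¹ ∙ x        ≈⟨ ∙-congʳ ε⁻¹≈ε ⟩
    ε ∙ x           ≈⟨ identityˡ x ⟩
    x               ∎)

  twist-cong : ∀ {x x' y y' f g} → x ≈ x' → y ≈ y' →
               x ≈ (f ⁻¹ ∙ y) ∙ g → x' ≈ (f ⁻¹ ∙ y') ∙ g
  twist-cong x≈x' y≈y' x≈fyg = trans (sym x≈x') (trans x≈fyg (∙-congʳ (∙-congˡ y≈y')))

  twist-⁻¹ : ∀ {x y f g} → x ≈ (f ⁻¹ ∙ y) ∙ g → x ⁻¹ ≈ (g ⁻¹ ∙ y ⁻¹) ∙ f
  twist-⁻¹ {x} {y} {f} {g} x≈fyg = begin
    x ⁻¹                      ≈⟨ ⁻¹-cong x≈fyg ⟩
    ((f ⁻¹ ∙ y) ∙ g) ⁻¹       ≈⟨ ⁻¹-anti-homo-∙ _ g ⟩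
    g ⁻¹ ∙ (f ⁻¹ ∙ y) ⁻¹      ≈⟨ ∙-congˡ (⁻¹-anti-homo-\\ f y) ⟩
    g ⁻¹ ∙ (y ⁻¹ ∙ f)         ≈⟨ assoc _ _ _ ⟨
    (g ⁻¹ ∙ y ⁻¹) ∙ f         ∎

  twist-∙ : ∀ {x x' y y' f g h} → x ≈ (f ⁻¹ ∙ x') ∙ g → y ≈ (g ⁻¹ ∙ y') ∙ h →
            x ∙ y ≈ (f ⁻¹ ∙ (x' ∙ y')) ∙ h
  twist-∙ {x} {x'} {y} {y'} {f} {g} {h} hx hy = begin
    x ∙ y                                  ≈⟨ ∙-cong hx hy ⟩
    ((f ⁻¹ ∙ x') ∙ g) ∙ ((g ⁻¹ ∙ y') ∙ h)  ≈⟨ assoc _ g _ ⟩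
    (f ⁻¹ ∙ x') ∙ (g ∙ ((g ⁻¹ ∙ y') ∙ h))  ≈⟨ ∙-congˡ (assoc g _ h) ⟨
    (f ⁻¹ ∙ x') ∙ ((g ∙ (g ⁻¹ ∙ y')) ∙ h)  ≈⟨ ∙-congˡ (∙-congʳ (\\-leftDividesˡ g y')) ⟩
    (f ⁻¹ ∙ x') ∙ (y' ∙ h)                 ≈⟨ assoc _ x' _ ⟩
    f ⁻¹ ∙ (x' ∙ (y' ∙ h))                 ≈⟨ ∙-congˡ (assoc x' y' h) ⟨
    f ⁻¹ ∙ ((x' ∙ y') ∙ h)                 ≈⟨ assoc _ _ h ⟨
    (f ⁻¹ ∙ (x' ∙ y')) ∙ h                 ∎

  twist-sym : ∀ {x y f g} → x ≈ (f ⁻¹ ∙ y) ∙ g → y ≈ ((f ⁻¹) ⁻¹ ∙ x) ∙ g ⁻¹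
  twist-sym {x} {y} {f} {g} x≈fyg = sym (begin
    ((f ⁻¹) ⁻¹ ∙ x) ∙ g ⁻¹              ≈⟨ ∙-congʳ (∙-congˡ x≈fyg) ⟩
    ((f ⁻¹) ⁻¹ ∙ ((f ⁻¹ ∙ y) ∙ g)) ∙ g ⁻¹ ≈⟨ ∙-congʳ (assoc _ _ g) ⟨
    (((f ⁻¹) ⁻¹ ∙ (f ⁻¹ ∙ y)) ∙ g) ∙ g ⁻¹ ≈⟨ //-rightDividesʳ g _ ⟩
    (f ⁻¹) ⁻¹ ∙ (f ⁻¹ ∙ y)              ≈⟨ \\-leftDividesʳ (f ⁻¹) y ⟩
    y                                   ∎)

  twist-trans : ∀ {x y z f f' k k'} → y ≈ (f ⁻¹ ∙ x) ∙ f' → z ≈ (k ⁻¹ ∙ y) ∙ k' →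
                z ≈ ((f ∙ k) ⁻¹ ∙ x) ∙ (f' ∙ k')
  twist-trans {x} {y} {z} {f} {f'} {k} {k'} hy hz = begin
    z                                  ≈⟨ hz ⟩
    (k ⁻¹ ∙ y) ∙ k'                    ≈⟨ ∙-congʳ (∙-congˡ hy) ⟩
    (k ⁻¹ ∙ ((f ⁻¹ ∙ x) ∙ f')) ∙ k'    ≈⟨ ∙-congʳ (assoc _ _ f') ⟨
    ((k ⁻¹ ∙ (f ⁻¹ ∙ x)) ∙ f') ∙ k'    ≈⟨ assoc _ f' k' ⟩
    (k ⁻¹ ∙ (f ⁻¹ ∙ x)) ∙ (f' ∙ k')    ≈⟨ ∙-congʳ (assoc _ _ x) ⟨
    ((k ⁻¹ ∙ f ⁻¹) ∙ x) ∙ (f' ∙ k')    ≈⟨ ∙-congʳ (∙-congʳ (⁻¹-anti-homo-∙ f k)) ⟨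
    ((f ∙ k) ⁻¹ ∙ x) ∙ (f' ∙ k')       ∎

  twist-solveʳ : ∀ f x y → y ≈ (f ⁻¹ ∙ x) ∙ ((x ⁻¹ ∙ f) ∙ y)
  twist-solveʳ f x y = sym (begin
    (f ⁻¹ ∙ x) ∙ ((x ⁻¹ ∙ f) ∙ y)      ≈⟨ assoc _ _ y ⟨
    ((f ⁻¹ ∙ x) ∙ (x ⁻¹ ∙ f)) ∙ y      ≈⟨ ∙-congʳ (∙-congʳ (⁻¹-anti-homo-\\ x f)) ⟨
    ((x ⁻¹ ∙ f) ⁻¹ ∙ (x ⁻¹ ∙ f)) ∙ y   ≈⟨ ∙-congʳ (inverseˡ _) ⟩
    ε ∙ y                              ≈⟨ identityˡ y ⟩
    y                                  ∎)

  twist-solveˡ : ∀ x g y → y ≈ (((x ∙ g) ∙ y ⁻¹) ⁻¹ ∙ x) ∙ g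
  twist-solveˡ x g y = sym (begin
    (((x ∙ g) ∙ y ⁻¹) ⁻¹ ∙ x) ∙ g      ≈⟨ ∙-congʳ (∙-congʳ (⁻¹-anti-homo-// (x ∙ g) y)) ⟩
    ((y ∙ (x ∙ g) ⁻¹) ∙ x) ∙ g         ≈⟨ assoc _ x g ⟩
    (y ∙ (x ∙ g) ⁻¹) ∙ (x ∙ g)         ≈⟨ //-rightDividesˡ (x ∙ g) y ⟩
    y                                  ∎)

module CentralTwist {c ℓ} (G : Group c ℓ) (s : Group.Carrier G) (s-central : Central G s) where
  open Group G
  open import Algebra.Properties.Group G
  open import Relation.Binary.Reasoning.Setoid setoid
  open Twist G

  s∙twist : ∀ f y g → s ∙ ((f ⁻¹ ∙ y) ∙ g) ≈ (f ⁻¹ ∙ (s ∙ y)) ∙ g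
  s∙twist f y g = begin
    s ∙ ((f ⁻¹ ∙ y) ∙ g)   ≈⟨ assoc s _ g ⟨
    (s ∙ (f ⁻¹ ∙ y)) ∙ g   ≈⟨ ∙-congʳ (assoc s _ y) ⟨
    ((s ∙ f ⁻¹) ∙ y) ∙ g   ≈⟨ ∙-congʳ (∙-congʳ (s-central (f ⁻¹))) ⟩
    ((f ⁻¹ ∙ s) ∙ y) ∙ g   ≈⟨ ∙-congʳ (assoc _ s y) ⟩
    (f ⁻¹ ∙ (s ∙ y)) ∙ g   ∎

  twist-central : ∀ {x y f g} → x ≈ (f ⁻¹ ∙ y) ∙ g → s ∙ x ≈ (f ⁻¹ ∙ (s ∙ y)) ∙ g
  twist-central {y = y} {f} {g} x≈fyg = trans (∙-congˡ x≈fyg) (s∙twist f y g)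

  untwist-central : ∀ {x y f g} → s ∙ x ≈ (f ⁻¹ ∙ (s ∙ y)) ∙ g → x ≈ (f ⁻¹ ∙ y) ∙ g
  untwist-central {x} {y} {f} {g} sx≈fsyg =
    ∙-cancelˡ s _ _ (trans sx≈fsyg (sym (s∙twist f y g)))

  twist-Ψ : ∀ {a a' b b' f g h} → a ≈ (f ⁻¹ ∙ a') ∙ g → b ≈ (h ⁻¹ ∙ b') ∙ g →
            (s ∙ a) ∙ b ⁻¹ ≈ (f ⁻¹ ∙ ((s ∙ a') ∙ b' ⁻¹)) ∙ h
  twist-Ψ ha hb = twist-cong (sym (assoc _ _ _)) (sym (assoc _ _ _))
    (twist-central (twist-∙ ha (twist-⁻¹ hb)))

  twist-ΨL : ∀ {c c' d d' f g h} → c ≈ (f ⁻¹ ∙ c') ∙ g → d ≈ (f ⁻¹ ∙ d') ∙ h →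
             (s ∙ c ⁻¹) ∙ d ≈ (g ⁻¹ ∙ ((s ∙ c' ⁻¹) ∙ d')) ∙ h
  twist-ΨL hc hd = twist-cong (sym (assoc _ _ _)) (sym (assoc _ _ _))
    (twist-central (twist-∙ (twist-⁻¹ hc) hd))

  untwist-Ψ : ∀ {a a' b b' F K} → (s ∙ a') ∙ b' ⁻¹ ≈ (F ⁻¹ ∙ ((s ∙ a) ∙ b ⁻¹)) ∙ K →
              b' ≈ (K ⁻¹ ∙ b) ∙ ((a ⁻¹ ∙ F) ∙ a')
  untwist-Ψ {a} {a'} {b} {b'} {F} h = twist-cong (cancel a' b') (cancel a b)
    (twist-∙ (twist-⁻¹ a'b'⁻¹-twisted) (twist-solveʳ F a a'))
    where
    a'b'⁻¹-twisted : a' ∙ b' ⁻¹ ≈ (F ⁻¹ ∙ (a ∙ b ⁻¹)) ∙ _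
    a'b'⁻¹-twisted = untwist-central (twist-cong (assoc _ _ _) (assoc _ _ _) h)
    cancel : ∀ x y → (x ∙ y ⁻¹) ⁻¹ ∙ x ≈ y
    cancel x y = trans (∙-congʳ (⁻¹-anti-homo-// x y)) (//-rightDividesˡ x y)

  untwist-ΨL : ∀ {c c' d d' g h} → (s ∙ c' ⁻¹) ∙ d' ≈ (g ⁻¹ ∙ ((s ∙ c ⁻¹) ∙ d)) ∙ h →
               d' ≈ ((((c ∙ g) ∙ c' ⁻¹) ⁻¹) ∙ d) ∙ h
  untwist-ΨL {c} {c'} {d} {d'} {g} h =
    twist-cong (\\-leftDividesˡ c' d') (\\-leftDividesˡ c d)
      (twist-∙ (twist-solveˡ c g c') c'⁻¹d'-twisted)
    where
    c'⁻¹d'-twisted : c' ⁻¹ ∙ d' ≈ (g ⁻¹ ∙ (c ⁻¹ ∙ d)) ∙ _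
    c'⁻¹d'-twisted = untwist-central (twist-cong (assoc _ _ _) (assoc _ _ _) h)

  s∙x∙s⁻¹≈x : ∀ x → (s ∙ x) ∙ s ⁻¹ ≈ x
  s∙x∙s⁻¹≈x x = trans (∙-congʳ (s-central x)) (//-rightDividesʳ s x)

  module _ (s²≈ε : s ∙ s ≈ ε) where

    flip-sign : ∀ u v → (s ∙ u) ∙ v ≈ ((s ∙ v ⁻¹) ∙ u ⁻¹) ⁻¹
    flip-sign u v = sym (begin
      ((s ∙ v ⁻¹) ∙ u ⁻¹) ⁻¹       ≈⟨ ⁻¹-anti-homo-// _ u ⟩
      u ∙ (s ∙ v ⁻¹) ⁻¹            ≈⟨ ∙-congˡ (⁻¹-anti-homo-// s v) ⟩
      u ∙ (v ∙ s ⁻¹)               ≈⟨ ∙-congˡ (∙-congˡ s⁻¹≈s) ⟩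
      u ∙ (v ∙ s)                  ≈⟨ ∙-congˡ (s-central v) ⟨
      u ∙ (s ∙ v)                  ≈⟨ assoc u s v ⟨
      (u ∙ s) ∙ v                  ≈⟨ ∙-congʳ (s-central u) ⟨
      (s ∙ u) ∙ v                  ∎)
      where
      s⁻¹≈s : s ⁻¹ ≈ s
      s⁻¹≈s = sym (inverseʳ-unique s s s²≈ε)

    flip-Ψ : ∀ x y → (s ∙ y) ∙ x ⁻¹ ≈ ((s ∙ x) ∙ y ⁻¹) ⁻¹
    flip-Ψ x y = trans (flip-sign y (x ⁻¹)) (⁻¹-cong (∙-congʳ (∙-congˡ (⁻¹-involutive x))))

    flip-ΨL : ∀ x y → (s ∙ y ⁻¹) ∙ x ≈ ((s ∙ x ⁻¹) ∙ y) ⁻¹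
    flip-ΨL x y = trans (flip-sign (y ⁻¹) x) (⁻¹-cong (∙-congˡ (⁻¹-involutive y)))

module Switching {c ℓ} (G : Group c ℓ) {V : Set} {A : V → V → Set} where
  open Group G
  open Twist G

  ≈⇒switch : {ψ₁ ψ₂ : RawGain G V A} → (∀ u v p → ψ₁ u v p ≈ ψ₂ u v p) → SwitchEq G A ψ₁ ψ₂
  ≈⇒switch ψ₁≈ψ₂ = (λ _ → ε) , λ u v p → twist-cong (ψ₁≈ψ₂ u v p) refl (twist-refl _)

  switch-sym : {ψ₁ ψ₂ : RawGain G V A} → SwitchEq G A ψ₁ ψ₂ → SwitchEq G A ψ₂ ψ₁
  switch-sym (f , sw) = (λ u → f u ⁻¹) , λ u v p → twist-sym (sw u v p)

  switch-trans : {ψ₁ ψ₂ ψ₃ : RawGain G V A} →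
                 SwitchEq G A ψ₁ ψ₂ → SwitchEq G A ψ₂ ψ₃ → SwitchEq G A ψ₁ ψ₃
  switch-trans (f , sw₁₂) (k , sw₂₃) =
    (λ u → f u ∙ k u) , λ u v p → twist-trans (sw₁₂ u v p) (sw₂₃ u v p)

module GraphFacts (Γ : Graph) where
  open Graph Γ

  Joins : Fin m → Fin n → Fin n → Set
  Joins k u v = (src k ≡ u × tgt k ≡ v) ⊎ (src k ≡ v × tgt k ≡ u)

  joins-sym : ∀ {k u v} → Joins k u v → Joins k v u
  joins-sym (inj₁ uv) = inj₂ uv
  joins-sym (inj₂ vu) = inj₁ vu

  joins-inc₁ : ∀ {k u v} → Joins k u v → Inc Γ u k
  joins-inc₁ (inj₁ (s≡u , _)) = inj₁ (≡.sym s≡u)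
  joins-inc₁ (inj₂ (_ , t≡u)) = inj₂ (≡.sym t≡u)

  joins-inc₂ : ∀ {k u v} → Joins k u v → Inc Γ v k
  joins-inc₂ = joins-inc₁ ∘ joins-sym

  joins-unique : ∀ {k k' u v} → Joins k u v → Joins k' u v → k ≡ k'
  joins-unique {k} {k'} (inj₁ (s≡u , t≡v)) (inj₁ (s'≡u , t'≡v)) =
    simple k k' (inj₁ (≡.trans s≡u (≡.sym s'≡u) , ≡.trans t≡v (≡.sym t'≡v)))
  joins-unique {k} {k'} (inj₁ (s≡u , t≡v)) (inj₂ (s'≡v , t'≡u)) =
    simple k k' (inj₂ (≡.trans s≡u (≡.sym t'≡u) , ≡.trans t≡v (≡.sym s'≡v)))
  joins-unique {k} {k'} (inj₂ (s≡v , t≡u)) (inj₁ (s'≡u , t'≡v)) =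
    simple k k' (inj₂ (≡.trans s≡v (≡.sym t'≡v) , ≡.trans t≡u (≡.sym s'≡u)))
  joins-unique {k} {k'} (inj₂ (s≡v , t≡u)) (inj₂ (s'≡v , t'≡u)) =
    simple k k' (inj₁ (≡.trans s≡v (≡.sym s'≡v) , ≡.trans t≡u (≡.sym t'≡u)))

  incident-joins : ∀ {k u v} → u ≢ v → Inc Γ u k → Inc Γ v k → Joins k u v
  incident-joins u≢v (inj₁ u≡s) (inj₁ v≡s) = ⊥-elim (u≢v (≡.trans u≡s (≡.sym v≡s)))
  incident-joins u≢v (inj₁ u≡s) (inj₂ v≡t) = inj₁ (≡.sym u≡s , ≡.sym v≡t)
  incident-joins u≢v (inj₂ u≡t) (inj₁ v≡s) = inj₂ (≡.sym v≡s , ≡.sym u≡t)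
  incident-joins u≢v (inj₂ u≡t) (inj₂ v≡t) = ⊥-elim (u≢v (≡.trans u≡t (≡.sym v≡t)))

  common-endpoint-unique : ∀ {i j u v} → i ≢ j →
                           Inc Γ u i → Inc Γ u j → Inc Γ v i → Inc Γ v j → u ≡ v
  common-endpoint-unique {u = u} {v} i≢j ui uj vi vj with u ≟ v
  ... | yes u≡v = u≡v
  ... | no u≢v = ⊥-elim (i≢j (joins-unique (incident-joins u≢v ui vi) (incident-joins u≢v uj vj)))

  edge-at-start : ∀ {u w} → Reachable Γ u w → Σ (Fin m) (Inc Γ w) → Σ (Fin m) (Inc Γ u)
  edge-at-start here at-w = at-w
  edge-at-start (step (e , joins) _) _ = e , joins-inc₁ joins

  incident-edge : Connected Γ → HasEdge Γ → ∀ v → Σ (Fin m) (Inc Γ v)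
  incident-edge conn he v = edge-at-start (conn v (src e₀)) (e₀ , inj₁ ≡.refl)
    where e₀ = fromℕ< (>-nonZero⁻¹ m ⦃ he ⦄)

module VertexGains {c ℓ} (Γ : Graph) (G : Group c ℓ) (s : Group.Carrier G) (s-central : Central G s) where
  open Graph Γ
  open Group G
  open GraphFacts Γ
  open Twist G
  open CentralTwist G s s-central
  open Switching G

  Ψ-isGain : s ∙ s ≈ ε → ∀ H → IsGain G (Adj Γ) (Ψ G Γ s H)
  Ψ-isGain s²≈ε H u v (k , uv) (k' , vu) with joins-unique vu (joins-sym uv)
  ... | ≡.refl = flip-Ψ s²≈ε (H u k) (H v k)

  along : ∀ k → Adj Γ (src k) (tgt k)
  along k = k , inj₁ (≡.refl , ≡.refl)

  against : ∀ k → Adj Γ (tgt k) (src k)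
  against k = k , inj₂ (≡.refl , ≡.refl)

  LRequiv⇒switch : ∀ {H₁ H₂} → LRequiv G Γ H₁ H₂ → SwitchEq G (Adj Γ) (Ψ G Γ s H₂) (Ψ G Γ s H₁)
  LRequiv⇒switch (f , g , H₁≈) =
    f , λ u v (k , uv) → twist-Ψ (H₁≈ u k (joins-inc₁ uv)) (H₁≈ v k (joins-inc₂ uv))

  switch⇒LRequiv : ∀ {H₁ H₂} → SwitchEq G (Adj Γ) (Ψ G Γ s H₂) (Ψ G Γ s H₁) → LRequiv G Γ H₁ H₂
  switch⇒LRequiv {H₁} {H₂} (f , sw) = f , g , H₁≈
    where
    g : Fin m → Carrier
    g k = (H₂ (src k) k ⁻¹ ∙ f (src k)) ∙ H₁ (src k) k
    H₁≈ : ∀ i k → Inc Γ i k → H₁ i k ≈ (f i ⁻¹ ∙ H₂ i k) ∙ g k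
    H₁≈ _ k (inj₁ ≡.refl) = twist-solveʳ (f (src k)) (H₂ (src k) k) (H₁ (src k) k)
    H₁≈ _ k (inj₂ ≡.refl) = untwist-Ψ (sw (src k) (tgt k) (along k))

  LRequiv⇔switch : ∀ H₁ H₂ → LRequiv G Γ H₁ H₂ ⇔ SwitchEq G (Adj Γ) (Ψ G Γ s H₁) (Ψ G Γ s H₂)
  LRequiv⇔switch H₁ H₂ = mk⇔ (switch-sym ∘ LRequiv⇒switch) (switch⇒LRequiv ∘ switch-sym)

  -- Entries of non-incident pairs are irrelevant; they get s as well.
  realise : RawGain G (Fin n) (Adj Γ) → Phase G Γ
  realise ψ i k with i ≟ src k
  ... | yes _ = ψ (src k) (tgt k) (along k)
  ... | no _ = s

  realise-src : ∀ ψ k → realise ψ (src k) k ≡ ψ (src k) (tgt k) (along k)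
  realise-src ψ k with src k ≟ src k
  ... | yes _ = ≡.refl
  ... | no s≢s = ⊥-elim (s≢s ≡.refl)

  realise-tgt : ∀ ψ k → realise ψ (tgt k) k ≡ s
  realise-tgt ψ k with tgt k ≟ src k
  ... | yes t≡s = ⊥-elim (loopless k (≡.sym t≡s))
  ... | no _ = ≡.refl

  Ψ-realise : s ∙ s ≈ ε → ∀ ψ → IsGain G (Adj Γ) ψ → SwitchEq G (Adj Γ) (Ψ G Γ s (realise ψ)) ψ
  Ψ-realise s²≈ε ψ ψ-gain = ≈⇒switch Ψ≈ψ
    where
    forward : ∀ k → Ψ G Γ s (realise ψ) (src k) (tgt k) (along k)
                    ≈ ψ (src k) (tgt k) (along k)
    forward k = trans (∙-cong (∙-congˡ (reflexive (realise-src ψ k)))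
                              (⁻¹-cong (reflexive (realise-tgt ψ k))))
                      (s∙x∙s⁻¹≈x _)
    Ψ≈ψ : ∀ u v p → Ψ G Γ s (realise ψ) u v p ≈ ψ u v p
    Ψ≈ψ _ _ (k , inj₁ (≡.refl , ≡.refl)) = forward k
    Ψ≈ψ _ _ (k , inj₂ (≡.refl , ≡.refl)) = begin
      Ψ G Γ s (realise ψ) (tgt k) (src k) (against k)
        ≈⟨ Ψ-isGain s²≈ε (realise ψ) (src k) (tgt k) (along k) (against k) ⟩
      Ψ G Γ s (realise ψ) (src k) (tgt k) (along k) ⁻¹
        ≈⟨ ⁻¹-cong (forward k) ⟩
      ψ (src k) (tgt k) (along k) ⁻¹
        ≈⟨ ψ-gain (src k) (tgt k) _ _ ⟨
      ψ (tgt k) (src k) (against k) ∎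
      where open import Relation.Binary.Reasoning.Setoid setoid

module EdgeGains {c ℓ} (Γ : Graph) (G : Group c ℓ) (s : Group.Carrier G) (s-central : Central G s) where
  open Graph Γ
  open Group G
  open GraphFacts Γ
  open Twist G
  open CentralTwist G s s-central
  open Switching G

  ΨL-isGain : s ∙ s ≈ ε → ∀ H → IsGain G (LAdj Γ) (ΨL G Γ s H)
  ΨL-isGain s²≈ε H i j (i≢j , u , ui , uj) (_ , v , vj , vi)
    with common-endpoint-unique i≢j ui uj vi vj
  ... | ≡.refl = flip-ΨL s²≈ε (H u i) (H u j)

  LRequiv⇒switch : ∀ {H₁ H₂} → LRequiv G Γ H₁ H₂ → SwitchEq G (LAdj Γ) (ΨL G Γ s H₂) (ΨL G Γ s H₁)
  LRequiv⇒switch (f , g , H₁≈) =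
    g , λ i j (_ , v , vi , vj) → twist-ΨL (H₁≈ v i vi) (H₁≈ v j vj)

  switch⇒LRequiv : Connected Γ → HasEdge Γ → ∀ {H₁ H₂} →
                   SwitchEq G (LAdj Γ) (ΨL G Γ s H₂) (ΨL G Γ s H₁) → LRequiv G Γ H₁ H₂
  switch⇒LRequiv conn he {H₁} {H₂} (g , sw) = f , g , H₁≈
    where
    -- Solving the twist equation at any edge e through v yields a factor
    -- that works at every edge through v.
    f-via : Fin n → Fin m → Carrier
    f-via v e = (H₂ v e ∙ g e) ∙ H₁ v e ⁻¹
    H₁≈-via : ∀ v e → Inc Γ v e → ∀ i → Inc Γ v i → H₁ v i ≈ (f-via v e ⁻¹ ∙ H₂ v i) ∙ g i
    H₁≈-via v e ve i vi with e ≟ i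
    ... | yes ≡.refl = twist-solveˡ (H₂ v e) (g e) (H₁ v e)
    ... | no e≢i = untwist-ΨL (sw e i (e≢i , v , ve , vi))
    f : Fin n → Carrier
    f v = f-via v (proj₁ (incident-edge conn he v))
    H₁≈ : ∀ v i → Inc Γ v i → H₁ v i ≈ (f v ⁻¹ ∙ H₂ v i) ∙ g i
    H₁≈ v = H₁≈-via v _ (proj₂ (incident-edge conn he v))

  LRequiv⇔switch : Connected Γ → HasEdge Γ →
                   ∀ H₁ H₂ → LRequiv G Γ H₁ H₂ ⇔ SwitchEq G (LAdj Γ) (ΨL G Γ s H₁) (ΨL G Γ s H₂)
  LRequiv⇔switch conn he H₁ H₂ =
    mk⇔ (switch-sym ∘ LRequiv⇒switch) (switch⇒LRequiv conn he ∘ switch-sym)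

theorem4p25 : {c ℓ : Level} (Γ : Graph) → Connected Γ → HasEdge Γ →
  (G : Group c ℓ) (s₁ s₂ : Group.Carrier G) →
  Central G s₁ → Central G s₂ →
  Group._≈_ G (Group._∙_ G s₁ s₁) (Group.ε G) →
  Group._≈_ G (Group._∙_ G s₂ s₂) (Group.ε G) →
  ((H₁ H₂ : Phase G Γ) →
    (LRequiv G Γ H₁ H₂ ⇔ SwitchEq G (Adj Γ) (Ψ G Γ s₁ H₁) (Ψ G Γ s₁ H₂))
    × (LRequiv G Γ H₁ H₂ ⇔ SwitchEq G (LAdj Γ) (ΨL G Γ s₂ H₁) (ΨL G Γ s₂ H₂)))
  × Σ (RawGain G (Vtx Γ) (Adj Γ) → RawGain G (Edg Γ) (LAdj Γ)) λ 𝓛 →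
      ((ψ : RawGain G (Vtx Γ) (Adj Γ)) → IsGain G (Adj Γ) ψ → IsGain G (LAdj Γ) (𝓛 ψ))
      × ((ψ₁ ψ₂ : RawGain G (Vtx Γ) (Adj Γ)) → IsGain G (Adj Γ) ψ₁ → IsGain G (Adj Γ) ψ₂ →
           SwitchEq G (Adj Γ) ψ₁ ψ₂ → SwitchEq G (LAdj Γ) (𝓛 ψ₁) (𝓛 ψ₂))
      × ((ψ₁ ψ₂ : RawGain G (Vtx Γ) (Adj Γ)) → IsGain G (Adj Γ) ψ₁ → IsGain G (Adj Γ) ψ₂ →
           SwitchEq G (LAdj Γ) (𝓛 ψ₁) (𝓛 ψ₂) → SwitchEq G (Adj Γ) ψ₁ ψ₂)
      × ((H : Phase G Γ) → SwitchEq G (LAdj Γ) (𝓛 (Ψ G Γ s₁ H)) (ΨL G Γ s₂ H))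
theorem4p25 Γ conn he G s₁ s₂ s₁-central s₂-central s₁²≈ε s₂²≈ε =
  (λ H₁ H₂ → V.LRequiv⇔switch H₁ H₂ , E.LRequiv⇔switch conn he H₁ H₂) ,
  𝓛 ,
  (λ ψ _ → E.ΨL-isGain s₂²≈ε (V.realise ψ)) ,
  (λ ψ₁ ψ₂ ψ₁-gain ψ₂-gain sw →
     Ψ⇒ΨL (switch-trans (switch-trans (realised ψ₁-gain) sw) (switch-sym (realised ψ₂-gain)))) ,
  (λ ψ₁ ψ₂ ψ₁-gain ψ₂-gain sw →
     switch-trans (switch-trans (switch-sym (realised ψ₁-gain)) (ΨL⇒Ψ sw)) (realised ψ₂-gain)) ,
  (λ H → Ψ⇒ΨL (realised (V.Ψ-isGain s₁²≈ε H)))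
  where
  module V = VertexGains Γ G s₁ s₁-central
  module E = EdgeGains Γ G s₂ s₂-central
  open Switching G
  open Equivalence using (to; from)

  𝓛 : RawGain G (Vtx Γ) (Adj Γ) → RawGain G (Edg Γ) (LAdj Γ)
  𝓛 ψ = ΨL G Γ s₂ (V.realise ψ)

  realised : ∀ {ψ} → IsGain G (Adj Γ) ψ → SwitchEq G (Adj Γ) (Ψ G Γ s₁ (V.realise ψ)) ψ
  realised = V.Ψ-realise s₁²≈ε _

  Ψ⇒ΨL : ∀ {H₁ H₂} → SwitchEq G (Adj Γ) (Ψ G Γ s₁ H₁) (Ψ G Γ s₁ H₂) →
         SwitchEq G (LAdj Γ) (ΨL G Γ s₂ H₁) (ΨL G Γ s₂ H₂)
  Ψ⇒ΨL = to (E.LRequiv⇔switch conn he _ _) ∘ from (V.LRequiv⇔switch _ _)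

  ΨL⇒Ψ : ∀ {H₁ H₂} → SwitchEq G (LAdj Γ) (ΨL G Γ s₂ H₁) (ΨL G Γ s₂ H₂) →
         SwitchEq G (Adj Γ) (Ψ G Γ s₁ H₁) (Ψ G Γ s₁ H₂)
  ΨL⇒Ψ = to (V.LRequiv⇔switch _ _) ∘ from (E.LRequiv⇔switch conn he _ _)
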